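{- Let $\Gamma$ be an alphabet and $E$ an infinite universe of events, and let $\mathbb{P}$, $0$, $1$, $\parallel$, $;$ be as defined in the context. Then $\langle \mathbb{P}, \subseteq\rangle$ is a complete lattice with join $\cup$ (set union) and least element $0$; for each $\Join\in\{\parallel, ;\}$, $\langle \mathbb{P}, \subseteq, \Join, 1\rangle$ is a unital quantale over $\cup$ (i.e. $\langle\mathbb{P},\Join,1\rangle$ is a monoid and $\Join$ distributes over unions in each argument); and for all $\mathcal{U},\mathcal{V},\mathcal{X},\mathcal{Y},\mathcal{Z},\mathcal{P}\in\mathbb{P}$ the following hold: $\mathcal{X}\subseteq\mathcal{Y}$ iff $\mathcal{X}\cup\mathcal{Y}=\mathcal{Y}$; $(\mathcal{U}\parallel\mathcal{V});(\mathcal{X}\parallel\mathcal{Y})\subseteq(\mathcal{U};\mathcal{X})\parallel(\mathcal{V};\mathcal{Y})$; $\mathcal{X}\cup(\mathcal{Y}\cup\mathcal{Z})=(\mathcal{X}\cup\mathcal{Y})\cup\mathcal{Z}$; $\mathcal{X}\cup\mathcal{X}=\mathcal{X}$; $\mathcal{X}\cup 0=0\cup\mathcal{X}=\mathcal{X}$; $\mathcal{X}\cup\mathcal{Y}=\mathcal{Y}\cup\mathcal{X}$; $\mathcal{X}\parallel\mathcal{Y}=\mathcal{Y}\parallel\mathcal{X}$; $\mathcal{X}\parallel 1=1\parallel\mathcal{X}=\mathcal{X}$ and $\mathcal{X};1=1;\mathcal{X}=\mathcal{X}$; $\mathcal{X}\parallel 0=0\parallel\mathcal{X}=0$ and $\mathcal{X};0=0;\mathcal{X}=0$;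 $\mathcal{X}\Join(\mathcal{Y}\cup\mathcal{Z})=(\mathcal{X}\Join\mathcal{Y})\cup(\mathcal{X}\Join\mathcal{Z})$ and $(\mathcal{X}\cup\mathcal{Y})\Join\mathcal{Z}=(\mathcal{X}\Join\mathcal{Z})\cup(\mathcal{Y}\Join\mathcal{Z})$ for $\Join\in\{\parallel,;\}$; $\mathcal{X}\Join(\mathcal{Y}\Join\mathcal{Z})=(\mathcal{X}\Join\mathcal{Y})\Join\mathcal{Z}$ for $\Join\in\{\parallel,;\}$; and for $\Join\in\{\parallel,;\}$ the map $\mathcal{X}\mapsto 1\cup(\mathcal{P}\Join\mathcal{X})$ on $\mathbb{P}$ has a least fixed point $\mathcal{P}^{\Join}=\mu\mathcal{X}.\,1\cup(\mathcal{P}\Join\mathcal{X})$.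
   Context: Fix an alphabet $\Gamma$ and a nonempty (infinite) set $E$ of events; it is a standing convention that $E$ is large enough that the event sets of the compositions below are again subsets of $E$. A partial string is a triple $p=\langle E_p,\alpha_p,\preceq_p\rangle$ with $E_p\subseteq E$, $\alpha_p\colon E_p\to\Gamma$ a function, and $\preceq_p$ a partial order on $E_p$. $\mathsf{P}_f$ denotes the set of finite partial strings ($E_p$ finite); $\bot$ is the empty partial string ($E_\bot=\emptyset$). A monotonic bijective morphism $f\colon x\to y$ is a bijection $f\colon E_x\to E_y$ with $e\preceq_x e'\Rightarrow f(e)\preceq_y f(e')$ and $\alpha_x(e)=\alpha_y(f(e))$ for all $e,e'\in E_x$. Write $x\sqsubseteq y$ iff there is a monotonic bijective morphism $y\to x$. For sets $S,T$ let $S+T=(S\times\{0\})\cup(T\times\{1\})$. For partial strings $x,y$, $x\parallel y$ and $x;y$ both have event set $E_x+E_y$ and labelling $\alpha(\langle e,0\rangle)=\alpha_x(e)$, $\alpha(\langle e,1\rangle)=\alpha_y(e)$; the order of $x\parallel y$ is: $\langle e,i\rangle\preceq\langle e',j\rangle$ iff ($i=j=0$ and $e\preceq_x e'$) or ($i=j=1$ and $e\preceq_y e'$); the order of $x;y$ is: $\langle e,i\rangle\preceq\langle e',j\rangle$ iff $i<j$ or $\langle e,i\rangle\preceq_{x\parallel y}\langle e',j\rangle$. A program is a set $\mathcal{X}\subseteq\mathsf{P}_f$ with $\downarrow\mathcal{X}=\mathcal{X}$, where $\downarrow\mathcal{X}=\{y\in\mathsf{P}_f\mid\exists x\in\mathcal{X}\colon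 y\sqsubseteq x\}$; $\mathbb{P}$ is the family of all programs. $0=\emptyset$, $1=\{\bot\}$. For programs $\mathcal{X},\mathcal{Y}$ and $\Join\in\{\parallel,;\}$, $\mathcal{X}\Join\mathcal{Y}=\downarrow\{x\Join y\mid x\in\mathcal{X},y\in\mathcal{Y}\}$. A unital quantale is a complete lattice $Q$ with a monoid structure $\langle Q,\cdot,1\rangle$ such that $x\cdot\bigvee S=\bigvee\{x\cdot y\mid y\in S\}$ and $(\bigvee S)\cdot x=\bigvee\{y\cdot x\mid y\in S\}$ for all $S\subseteq Q$, $x\in Q$. -}

module Defs where

open import Level using (Level; _⊔_) renaming (suc to lsuc; zero to lzero)
open import Data.Nat using (ℕ; zero; _+_)
open import Data.Fin using (Fin; splitAt)
open import Data.Bool using (Bool; true; false)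
open import Data.Sum using (_⊎_; inj₁; inj₂; [_,_])
open import Data.Product using (Σ; ∃; _×_; _,_; proj₁; proj₂)
open import Data.Empty using (⊥)
open import Function using (_∘_)
open import Function.Definitions using (Bijective)
import Function.Construct.Composition as FComp
open import Relation.Binary.PropositionalEquality using (_≡_; refl; sym; trans)
open import Relation.Binary.Core using (Rel)
open import Relation.Binary.Structures using (IsPartialOrder)
open import Algebra.Structures using (IsMonoid)

-- Generic order-theoretic notions.
-- Joins are taken over families indexed by a type I : Set ι
-- (the predicative rendering of "for all subsets S").

record IsCompleteLattice {a ℓ₁ ℓ₂} (ι : Level) {A : Set a}
         (_≈_ : Rel A ℓ₁) (_≤_ : Rel A ℓ₂)
         (⋁ : ∀ {I : Set ι} → (I → A) → A) : Set (a ⊔ ℓ₁ ⊔ ℓ₂ ⊔ lsuc ι) where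
  field
    isPartialOrder : IsPartialOrder _≈_ _≤_
    ⋁-upper : ∀ {I : Set ι} (F : I → A) (i : I) → F i ≤ ⋁ F
    ⋁-least : ∀ {I : Set ι} (F : I → A) (z : A) → (∀ i → F i ≤ z) → ⋁ F ≤ z

record IsUnitalQuantale {a ℓ₁ ℓ₂} (ι : Level) {A : Set a}
         (_≈_ : Rel A ℓ₁) (_≤_ : Rel A ℓ₂)
         (⋁ : ∀ {I : Set ι} → (I → A) → A)
         (_·_ : A → A → A) (e : A) : Set (a ⊔ ℓ₁ ⊔ ℓ₂ ⊔ lsuc ι) where
  field
    isCompleteLattice : IsCompleteLattice ι _≈_ _≤_ ⋁
    isMonoid : IsMonoid _≈_ _·_ e
    distribˡ : ∀ (x : A) {I : Set ι} (F : I → A) → (x · ⋁ F) ≈ ⋁ (λ i → x · F i)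
    distribʳ : ∀ (x : A) {I : Set ι} (F : I → A) → (⋁ F · x) ≈ ⋁ (λ i → F i · x)

-- Event sets of finite partial strings are represented as Fin n ⊆ ℕ
-- (so E = ℕ, an infinite universe of events); E_x + E_y is Fin (n + m)
-- with tag 0 / tag 1 given by splitAt (inj₁ / inj₂).

module PartialStrings (Γ : Set) where

  record PStr : Set where
    constructor mkPS
    field
      size : ℕ
      lab  : Fin size → Γ
      ord  : Fin size → Fin size → Bool

  open PStr public

  IsPartialString : PStr → Set
  IsPartialString p =
      (∀ e → ord p e e ≡ true)
    × (∀ e e' → ord p e e' ≡ true → ord p e' e ≡ true → e ≡ e')
    × (∀ e e' e'' → ord p e e' ≡ true → ord p e' e'' ≡ true → ord p e e'' ≡ true)

  ⊥ₚ : PStr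
  ⊥ₚ = mkPS zero (λ ()) (λ ())

  MBMorphism : PStr → PStr → Set
  MBMorphism x y =
    Σ (Fin (size x) → Fin (size y)) λ f →
        Bijective _≡_ _≡_ f
      × (∀ e e' → ord x e e' ≡ true → ord y (f e) (f e') ≡ true)
      × (∀ e → lab x e ≡ lab y (f e))

  _⊑_ : PStr → PStr → Set
  x ⊑ y = MBMorphism y x

  ⊑-trans : ∀ {x y z} → x ⊑ y → y ⊑ z → x ⊑ z
  ⊑-trans {x} {y} {z} (f , fb , fm , fl) (g , gb , gm , gl) =
    f ∘ g , FComp.bijective _≡_ _≡_ _≡_ gb fb
          , (λ e e' p → fm (g e) (g e') (gm e e' p))
          , (λ e → trans (gl e) (fl (g e)))

  parOrd : ∀ {n m} → (Fin n → Fin n → Bool) → (Fin m → Fin m → Bool)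
         → Fin n ⊎ Fin m → Fin n ⊎ Fin m → Bool
  parOrd ox oy (inj₁ e) (inj₁ e') = ox e e'
  parOrd ox oy (inj₂ e) (inj₂ e') = oy e e'
  parOrd ox oy (inj₁ e) (inj₂ e') = false
  parOrd ox oy (inj₂ e) (inj₁ e') = false

  seqOrd : ∀ {n m} → (Fin n → Fin n → Bool) → (Fin m → Fin m → Bool)
         → Fin n ⊎ Fin m → Fin n ⊎ Fin m → Bool
  seqOrd ox oy (inj₁ e) (inj₁ e') = ox e e'
  seqOrd ox oy (inj₂ e) (inj₂ e') = oy e e'
  seqOrd ox oy (inj₁ e) (inj₂ e') = true
  seqOrd ox oy (inj₂ e) (inj₁ e') = false

  _∥ₚ_ : PStr → PStr → PStr
  x ∥ₚ y = mkPS (size x + size y)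
                (λ e → [ lab x , lab y ] (splitAt (size x) e))
                (λ e e' → parOrd (ord x) (ord y) (splitAt (size x) e) (splitAt (size x) e'))

  _⨾ₚ_ : PStr → PStr → PStr
  x ⨾ₚ y = mkPS (size x + size y)
                (λ e → [ lab x , lab y ] (splitAt (size x) e))
                (λ e e' → seqOrd (ord x) (ord y) (splitAt (size x) e) (splitAt (size x) e'))

  record Program : Set₁ where
    constructor mkProgram
    field
      mem    : PStr → Set
      isPS   : ∀ p → mem p → IsPartialString p
      closed : ∀ x y → mem x → IsPartialString y → y ⊑ x → mem y

  open Program public

  ↓ : (PStr → Set) → Program
  ↓ S = mkProgram (λ y → IsPartialString y × ∃ λ x → S x × y ⊑ x)
                  (λ _ m → proj₁ m)
                  (λ x y (_ , x′ , sx′ , x⊑x′) psy y⊑x →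
                     psy , x′ , sx′ , ⊑-trans {y} {x} {x′} y⊑x x⊑x′)

  _⊆_ : Program → Program → Set
  X ⊆ Y = ∀ p → mem X p → mem Y p

  _≐_ : Program → Program → Set
  X ≐ Y = X ⊆ Y × Y ⊆ X

  𝟘 : Program
  𝟘 = mkProgram (λ _ → ⊥) (λ _ ()) (λ _ _ ())

  𝟙 : Program
  𝟙 = ↓ (λ p → p ≡ ⊥ₚ)

  _∪_ : Program → Program → Program
  X ∪ Y = mkProgram (λ p → mem X p ⊎ mem Y p)
                    (λ { p (inj₁ m) → isPS X p m ; p (inj₂ m) → isPS Y p m })
                    (λ { x y (inj₁ m) ps le → inj₁ (closed X x y m ps le)
                       ; x y (inj₂ m) ps le → inj₂ (closed Y x y m ps le) })

  ⋃ : ∀ {I : Set} → (I → Program) → Program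
  ⋃ {I} F = mkProgram (λ p → ∃ λ (i : I) → mem (F i) p)
                      (λ p (i , m) → isPS (F i) p m)
                      (λ x y (i , m) ps le → i , closed (F i) x y m ps le)

  data Comp : Set where
    par seq : Comp

  _⟪_⟫ₚ_ : PStr → Comp → PStr → PStr
  x ⟪ par ⟫ₚ y = x ∥ₚ y
  x ⟪ seq ⟫ₚ y = x ⨾ₚ y

  _⟪_⟫_ : Program → Comp → Program → Program
  X ⟪ c ⟫ Y = ↓ (λ z → ∃ λ x → ∃ λ y → mem X x × mem Y y × z ≡ x ⟪ c ⟫ₚ y)

  _∥_ : Program → Program → Program
  X ∥ Y = X ⟪ par ⟫ Y

  _⨾_ : Program → Program → Program
  X ⨾ Y = X ⟪ seq ⟫ Y

  IsLeastFixedPoint : (Program → Program) → Program → Set₁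
  IsLeastFixedPoint φ Q = (Q ≐ φ Q) × (∀ X → X ≐ φ X → Q ⊆ X)

-- A composition x ⟪ c ⟫ₚ y is, up to order isomorphism, the disjoint sum of the events of x and y,
-- ordered inside each summand and, for sequential composition, with every event of x below every
-- event of y.  Associativity, units and commutativity of ∥ are therefore reorderings of ⊎ that
-- preserve the order exactly, and the exchange law is a reordering that only adds order.  Since ⊑
-- is monotone in both arguments of a composition, these string-level facts lift to programs: an
-- element of X ⟪ c ⟫ Y lies below some x ⟪ c ⟫ₚ y, and programs are closed downwards.  Programs
-- are closed under arbitrary unions, so they form a complete lattice, and the least fixed point of
-- X ↦ 1 ∪ (P ⟪ c ⟫ X) is the union of its Kleene iterates from 0.
module Submission where

open import Defs
open import Level using () renaming (zero to lzero)
open import Data.Bool using (Bool; true; false)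
open import Data.Empty using (⊥-elim)
open import Data.Fin using (Fin; splitAt)
open import Data.Fin.Properties using (+↔⊎)
open import Data.Nat using (ℕ; zero; suc)
open import Data.Product using (∃; _×_; _,_; proj₁)
open import Data.Sum using (_⊎_; inj₁; inj₂; [_,_]; map₂; swap; assocˡ; assocʳ; reduce)
open import Data.Sum.Algebra using (⊎-cong; ⊎-comm; ⊎-assoc)
open import Function using (_∘_; id)
open import Function.Bundles using (_⇔_; mk⇔; _↔_; Inverse; Bijection; mk⤖; mk↔ₛ′)
open import Function.Properties.Bijection using (⤖⇒↔)
open import Function.Properties.Inverse using (↔-refl; ↔-sym; ↔-trans; ↔⇒⤖)
open import Relation.Binary.PropositionalEquality using (_≡_; refl; sym; trans; cong; cong₂)
open import Relation.Binary.Structures using (IsPartialOrder; IsEquivalence)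

module PartialStringAlgebra (Γ : Set) where
  open PartialStrings Γ

  -- Labelled relations on an arbitrary event type, so that sums of sums can be formed.
  record Structure : Set₁ where
    constructor structure
    field
      Event : Set
      label : Event → Γ
      order : Event → Event → Bool

  open Structure

  ⟦_⟧ : PStr → Structure
  ⟦ p ⟧ = structure (Fin (size p)) (lab p) (ord p)

  IsPomset : Structure → Set
  IsPomset S =
      (∀ e → order S e e ≡ true)
    × (∀ e e' → order S e e' ≡ true → order S e' e ≡ true → e ≡ e')
    × (∀ e e' e'' → order S e e' ≡ true → order S e' e'' ≡ true → order S e e'' ≡ true)

  precedes : Comp → Bool
  precedes par = false
  precedes seq = true

  composeOrder : ∀ {A B : Set} → Comp → (A → A → Bool) → (B → B → Bool) → A ⊎ B → A ⊎ B → Bool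
  composeOrder c ≤₁ ≤₂ (inj₁ a) (inj₁ a') = ≤₁ a a'
  composeOrder c ≤₁ ≤₂ (inj₂ b) (inj₂ b') = ≤₂ b b'
  composeOrder c ≤₁ ≤₂ (inj₁ a) (inj₂ b)  = precedes c
  composeOrder c ≤₁ ≤₂ (inj₂ b) (inj₁ a)  = false

  _⟪_⟫ˢ_ : Structure → Comp → Structure → Structure
  S ⟪ c ⟫ˢ T = structure (Event S ⊎ Event T) [ label S , label T ] (composeOrder c (order S) (order T))

  record _↝_ (S T : Structure) : Set where
    field
      bijection : Event S ↔ Event T
    open Inverse bijection public using (to)
    field
      monotone : ∀ a a' → order S a a' ≡ true → order T (to a) (to a') ≡ true
      label-preserving : ∀ a → label S a ≡ label T (to a)

  record _≅_ (S T : Structure) : Set where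
    field
      bijection : Event S ↔ Event T
    open Inverse bijection public using (to; from; strictlyInverseˡ)
    field
      order-preserving : ∀ a a' → order T (to a) (to a') ≡ order S a a'
      label-preserving : ∀ a → label S a ≡ label T (to a)

  module ↝ = _↝_
  module ≅ = _≅_

  infixr 5 _↝∙_ _≅∙_

  _↝∙_ : ∀ {S T U} → S ↝ T → T ↝ U → S ↝ U
  h ↝∙ k = record
    { bijection = ↔-trans (↝.bijection h) (↝.bijection k)
    ; monotone = λ a a' → ↝.monotone k _ _ ∘ ↝.monotone h a a'
    ; label-preserving = λ a → trans (↝.label-preserving h a) (↝.label-preserving k (↝.to h a))
    }

  ≅-refl : ∀ {S} → S ≅ S
  ≅-refl = record { bijection = ↔-refl ; order-preserving = λ _ _ → refl ; label-preserving = λ _ → refl }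

  _≅∙_ : ∀ {S T U} → S ≅ T → T ≅ U → S ≅ U
  h ≅∙ k = record
    { bijection = ↔-trans (≅.bijection h) (≅.bijection k)
    ; order-preserving = λ a a' → trans (≅.order-preserving k _ _) (≅.order-preserving h a a')
    ; label-preserving = λ a → trans (≅.label-preserving h a) (≅.label-preserving k (≅.to h a))
    }

  ≅-sym : ∀ {S T} → S ≅ T → T ≅ S
  ≅-sym {S} {T} h = record
    { bijection = ↔-sym bijection
    ; order-preserving = λ b b' →
        trans (sym (order-preserving (from b) (from b')))
              (cong₂ (order T) (strictlyInverseˡ b) (strictlyInverseˡ b'))
    ; label-preserving = λ b →
        trans (cong (label T) (sym (strictlyInverseˡ b))) (sym (label-preserving (from b)))
    }
    where open _≅_ h

  ≅⇒↝ : ∀ {S T} → S ≅ T → S ↝ T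
  ≅⇒↝ h = record
    { bijection = ≅.bijection h
    ; monotone = λ a a' → trans (≅.order-preserving h a a')
    ; label-preserving = ≅.label-preserving h
    }

  ≅-isPomset : ∀ {S T} → S ≅ T → IsPomset T → IsPomset S
  ≅-isPomset {S} {T} h (reflexive , antisymmetric , transitive) =
      (λ e → trans (sym (order-preserving e e)) (reflexive (to e)))
    , (λ e e' p q → to-injective (antisymmetric (to e) (to e') (transport p) (transport q)))
    , (λ e e' e'' p q → trans (sym (order-preserving e e'')) (transitive _ _ _ (transport p) (transport q)))
    where
    open _≅_ h
    transport : ∀ {a a'} → order S a a' ≡ true → order T (to a) (to a') ≡ true
    transport = trans (order-preserving _ _)
    to-injective : ∀ {a a'} → to a ≡ to a' → a ≡ a'
    to-injective = Bijection.injective (↔⇒⤖ bijection)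

  ⟪⟫ˢ-isPomset : ∀ c {S T} → IsPomset S → IsPomset T → IsPomset (S ⟪ c ⟫ˢ T)
  ⟪⟫ˢ-isPomset c {S} {T} (reflexive₁ , antisymmetric₁ , transitive₁)
                         (reflexive₂ , antisymmetric₂ , transitive₂) =
    reflexive , antisymmetric , transitive
    where
    _≤_ : Event (S ⟪ c ⟫ˢ T) → Event (S ⟪ c ⟫ˢ T) → Bool
    _≤_ = order (S ⟪ c ⟫ˢ T)
    reflexive : ∀ e → e ≤ e ≡ true
    reflexive (inj₁ a) = reflexive₁ a
    reflexive (inj₂ b) = reflexive₂ b
    antisymmetric : ∀ e e' → e ≤ e' ≡ true → e' ≤ e ≡ true → e ≡ e'
    antisymmetric (inj₁ a) (inj₁ a') p q = cong inj₁ (antisymmetric₁ a a' p q)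
    antisymmetric (inj₁ a) (inj₂ b)  p ()
    antisymmetric (inj₂ b) (inj₁ a)  ()
    antisymmetric (inj₂ b) (inj₂ b') p q = cong inj₂ (antisymmetric₂ b b' p q)
    transitive : ∀ e e' e'' → e ≤ e' ≡ true → e' ≤ e'' ≡ true → e ≤ e'' ≡ true
    transitive (inj₁ a) (inj₁ a') (inj₁ a'') p q = transitive₁ a a' a'' p q
    transitive (inj₁ a) (inj₁ a') (inj₂ b)   p q = q
    transitive (inj₁ a) (inj₂ b)  (inj₁ a')  p ()
    transitive (inj₁ a) (inj₂ b)  (inj₂ b')  p q = p
    transitive (inj₂ b) (inj₁ a)  e''        ()
    transitive (inj₂ b) (inj₂ b') (inj₁ a)   p ()
    transitive (inj₂ b) (inj₂ b') (inj₂ b'') p q = transitive₂ b b' b'' p q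

  ⟪⟫ˢ-cong : ∀ c {S S' T T'} → S ≅ S' → T ≅ T' → (S ⟪ c ⟫ˢ T) ≅ (S' ⟪ c ⟫ˢ T')
  ⟪⟫ˢ-cong c h k = record
    { bijection = ⊎-cong (≅.bijection h) (≅.bijection k)
    ; order-preserving = λ
        { (inj₁ a) (inj₁ a') → ≅.order-preserving h a a'
        ; (inj₁ a) (inj₂ b)  → refl
        ; (inj₂ b) (inj₁ a)  → refl
        ; (inj₂ b) (inj₂ b') → ≅.order-preserving k b b' }
    ; label-preserving = [ ≅.label-preserving h , ≅.label-preserving k ]
    }

  ⟪⟫ˢ-mono : ∀ c {S S' T T'} → S ↝ S' → T ↝ T' → (S ⟪ c ⟫ˢ T) ↝ (S' ⟪ c ⟫ˢ T')
  ⟪⟫ˢ-mono c h k = record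
    { bijection = ⊎-cong (↝.bijection h) (↝.bijection k)
    ; monotone = λ
        { (inj₁ a) (inj₁ a') → ↝.monotone h a a'
        ; (inj₁ a) (inj₂ b)  → id
        ; (inj₂ b) (inj₁ a)  ()
        ; (inj₂ b) (inj₂ b') → ↝.monotone k b b' }
    ; label-preserving = [ ↝.label-preserving h , ↝.label-preserving k ]
    }

  ⟪⟫ˢ-assoc : ∀ c {S T U} → ((S ⟪ c ⟫ˢ T) ⟪ c ⟫ˢ U) ≅ (S ⟪ c ⟫ˢ (T ⟪ c ⟫ˢ U))
  ⟪⟫ˢ-assoc c = record
    { bijection = ⊎-assoc lzero _ _ _
    ; order-preserving = λ
        { (inj₁ (inj₁ a)) (inj₁ (inj₁ a')) → refl
        ; (inj₁ (inj₁ a)) (inj₁ (inj₂ b))  → refl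
        ; (inj₁ (inj₁ a)) (inj₂ d)         → refl
        ; (inj₁ (inj₂ b)) (inj₁ (inj₁ a))  → refl
        ; (inj₁ (inj₂ b)) (inj₁ (inj₂ b')) → refl
        ; (inj₁ (inj₂ b)) (inj₂ d)         → refl
        ; (inj₂ d)        (inj₁ (inj₁ a))  → refl
        ; (inj₂ d)        (inj₁ (inj₂ b))  → refl
        ; (inj₂ d)        (inj₂ d')        → refl }
    ; label-preserving = λ { (inj₁ (inj₁ a)) → refl ; (inj₁ (inj₂ b)) → refl ; (inj₂ d) → refl }
    }

  ∥ˢ-comm : ∀ {S T} → (S ⟪ par ⟫ˢ T) ≅ (T ⟪ par ⟫ˢ S)
  ∥ˢ-comm = record
    { bijection = ⊎-comm _ _
    ; order-preserving = λ
        { (inj₁ a) (inj₁ a') → refl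
        ; (inj₁ a) (inj₂ b)  → refl
        ; (inj₂ b) (inj₁ a)  → refl
        ; (inj₂ b) (inj₂ b') → refl }
    ; label-preserving = λ { (inj₁ a) → refl ; (inj₂ b) → refl }
    }

  ⟪⟫ˢ-identityʳ : ∀ c {S} → (S ⟪ c ⟫ˢ ⟦ ⊥ₚ ⟧) ≅ S
  ⟪⟫ˢ-identityʳ c = record
    { bijection = mk↔ₛ′ [ id , (λ ()) ] inj₁ (λ _ → refl) [ (λ _ → refl) , (λ ()) ]
    ; order-preserving = λ { (inj₁ a) (inj₁ a') → refl ; (inj₁ a) (inj₂ ()) ; (inj₂ ()) _ }
    ; label-preserving = λ { (inj₁ a) → refl ; (inj₂ ()) }
    }

  ⟪⟫ˢ-identityˡ : ∀ c {S} → (⟦ ⊥ₚ ⟧ ⟪ c ⟫ˢ S) ≅ S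
  ⟪⟫ˢ-identityˡ c = record
    { bijection = mk↔ₛ′ [ (λ ()) , id ] inj₂ (λ _ → refl) [ (λ ()) , (λ _ → refl) ]
    ; order-preserving = λ { (inj₂ b) (inj₂ b') → refl ; (inj₂ b) (inj₁ ()) ; (inj₁ ()) _ }
    ; label-preserving = λ { (inj₂ b) → refl ; (inj₁ ()) }
    }

  interchange : ∀ {A B C D : Set} → (A ⊎ B) ⊎ (C ⊎ D) → (A ⊎ C) ⊎ (B ⊎ D)
  interchange (inj₁ (inj₁ a)) = inj₁ (inj₁ a)
  interchange (inj₁ (inj₂ b)) = inj₂ (inj₁ b)
  interchange (inj₂ (inj₁ c)) = inj₁ (inj₂ c)
  interchange (inj₂ (inj₂ d)) = inj₂ (inj₂ d)

  interchange-involutive : ∀ {A B C D : Set} (u : (A ⊎ B) ⊎ (C ⊎ D)) → interchange (interchange u) ≡ u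
  interchange-involutive (inj₁ (inj₁ a)) = refl
  interchange-involutive (inj₁ (inj₂ b)) = refl
  interchange-involutive (inj₂ (inj₁ c)) = refl
  interchange-involutive (inj₂ (inj₂ d)) = refl

  exchangeˢ : ∀ {S T U V} →
    ((S ⟪ seq ⟫ˢ T) ⟪ par ⟫ˢ (U ⟪ seq ⟫ˢ V)) ↝ ((S ⟪ par ⟫ˢ U) ⟪ seq ⟫ˢ (T ⟪ par ⟫ˢ V))
  exchangeˢ = record
    { bijection = mk↔ₛ′ interchange interchange interchange-involutive interchange-involutive
    ; monotone = λ
        { (inj₁ (inj₁ s)) (inj₁ (inj₁ s')) → id
        ; (inj₁ (inj₁ s)) (inj₁ (inj₂ t))  → id
        ; (inj₁ (inj₂ t)) (inj₁ (inj₁ s))  ()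
        ; (inj₁ (inj₂ t)) (inj₁ (inj₂ t')) → id
        ; (inj₁ _)        (inj₂ _)         ()
        ; (inj₂ _)        (inj₁ _)         ()
        ; (inj₂ (inj₁ u)) (inj₂ (inj₁ u')) → id
        ; (inj₂ (inj₁ u)) (inj₂ (inj₂ v))  → id
        ; (inj₂ (inj₂ v)) (inj₂ (inj₁ u))  ()
        ; (inj₂ (inj₂ v)) (inj₂ (inj₂ v')) → id }
    ; label-preserving = λ
        { (inj₁ (inj₁ s)) → refl ; (inj₁ (inj₂ t)) → refl ; (inj₂ (inj₁ u)) → refl ; (inj₂ (inj₂ v)) → refl }
    }

  ∥ₚ-order : ∀ x y e e' →
    composeOrder par (ord x) (ord y) (splitAt (size x) e) (splitAt (size x) e') ≡ ord (x ∥ₚ y) e e'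
  ∥ₚ-order x y e e' with splitAt (size x) e | splitAt (size x) e'
  ... | inj₁ _ | inj₁ _ = refl
  ... | inj₁ _ | inj₂ _ = refl
  ... | inj₂ _ | inj₁ _ = refl
  ... | inj₂ _ | inj₂ _ = refl

  ⨾ₚ-order : ∀ x y e e' →
    composeOrder seq (ord x) (ord y) (splitAt (size x) e) (splitAt (size x) e') ≡ ord (x ⨾ₚ y) e e'
  ⨾ₚ-order x y e e' with splitAt (size x) e | splitAt (size x) e'
  ... | inj₁ _ | inj₁ _ = refl
  ... | inj₁ _ | inj₂ _ = refl
  ... | inj₂ _ | inj₁ _ = refl
  ... | inj₂ _ | inj₂ _ = refl

  ⟦⟪⟫ₚ⟧ : ∀ c x y → ⟦ x ⟪ c ⟫ₚ y ⟧ ≅ (⟦ x ⟧ ⟪ c ⟫ˢ ⟦ y ⟧)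
  ⟦⟪⟫ₚ⟧ par x y = record { bijection = +↔⊎ ; order-preserving = ∥ₚ-order x y ; label-preserving = λ _ → refl }
  ⟦⟪⟫ₚ⟧ seq x y = record { bijection = +↔⊎ ; order-preserving = ⨾ₚ-order x y ; label-preserving = λ _ → refl }

  ⟪⟫ₚ-isPartialString : ∀ c {x y} → IsPartialString x → IsPartialString y → IsPartialString (x ⟪ c ⟫ₚ y)
  ⟪⟫ₚ-isPartialString c {x} {y} px py = ≅-isPomset (⟦⟪⟫ₚ⟧ c x y) (⟪⟫ˢ-isPomset c {⟦ x ⟧} {⟦ y ⟧} px py)

  ⊥ₚ-isPartialString : IsPartialString ⊥ₚ
  ⊥ₚ-isPartialString = (λ ()) , (λ ()) , (λ ())

  ⊑-refl : ∀ {x} → x ⊑ x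
  ⊑-refl = id , (id , λ e → e , id) , (λ _ _ → id) , (λ _ → refl)

  ↝⇒⊑ : ∀ {x y} → ⟦ y ⟧ ↝ ⟦ x ⟧ → x ⊑ y
  ↝⇒⊑ h = to , Bijection.bijective (↔⇒⤖ bijection) , monotone , label-preserving
    where open _↝_ h

  ⊑⇒↝ : ∀ {x y} → x ⊑ y → ⟦ y ⟧ ↝ ⟦ x ⟧
  ⊑⇒↝ (f , f-bijective , f-monotone , f-label) = record
    { bijection = ⤖⇒↔ (mk⤖ f-bijective) ; monotone = f-monotone ; label-preserving = f-label }

  ≅⇒⊒ : ∀ {x y} → ⟦ x ⟧ ≅ ⟦ y ⟧ → y ⊑ x
  ≅⇒⊒ = ↝⇒⊑ ∘ ≅⇒↝

  ≅⇒⊑ : ∀ {x y} → ⟦ x ⟧ ≅ ⟦ y ⟧ → x ⊑ y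
  ≅⇒⊑ = ≅⇒⊒ ∘ ≅-sym

  ⟪⟫ₚ-mono : ∀ c {x x' y y'} → x' ⊑ x → y' ⊑ y → (x' ⟪ c ⟫ₚ y') ⊑ (x ⟪ c ⟫ₚ y)
  ⟪⟫ₚ-mono c {x} {x'} {y} {y'} x'⊑x y'⊑y =
    ↝⇒⊑ (≅⇒↝ (⟦⟪⟫ₚ⟧ c x y) ↝∙ ⟪⟫ˢ-mono c (⊑⇒↝ x'⊑x) (⊑⇒↝ y'⊑y) ↝∙ ≅⇒↝ (≅-sym (⟦⟪⟫ₚ⟧ c x' y')))

  ⟪⟫ₚ-assoc : ∀ c x y z → ⟦ (x ⟪ c ⟫ₚ y) ⟪ c ⟫ₚ z ⟧ ≅ ⟦ x ⟪ c ⟫ₚ (y ⟪ c ⟫ₚ z) ⟧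
  ⟪⟫ₚ-assoc c x y z =
    ⟦⟪⟫ₚ⟧ c (x ⟪ c ⟫ₚ y) z ≅∙ ⟪⟫ˢ-cong c (⟦⟪⟫ₚ⟧ c x y) ≅-refl ≅∙ ⟪⟫ˢ-assoc c
      ≅∙ ⟪⟫ˢ-cong c ≅-refl (≅-sym (⟦⟪⟫ₚ⟧ c y z)) ≅∙ ≅-sym (⟦⟪⟫ₚ⟧ c x (y ⟪ c ⟫ₚ z))

  ∥ₚ-comm : ∀ x y → ⟦ x ∥ₚ y ⟧ ≅ ⟦ y ∥ₚ x ⟧
  ∥ₚ-comm x y = ⟦⟪⟫ₚ⟧ par x y ≅∙ ∥ˢ-comm ≅∙ ≅-sym (⟦⟪⟫ₚ⟧ par y x)

  ⟪⟫ₚ-identityʳ : ∀ c x → ⟦ x ⟪ c ⟫ₚ ⊥ₚ ⟧ ≅ ⟦ x ⟧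
  ⟪⟫ₚ-identityʳ c x = ⟦⟪⟫ₚ⟧ c x ⊥ₚ ≅∙ ⟪⟫ˢ-identityʳ c

  ⟪⟫ₚ-identityˡ : ∀ c x → ⟦ ⊥ₚ ⟪ c ⟫ₚ x ⟧ ≅ ⟦ x ⟧
  ⟪⟫ₚ-identityˡ c x = ⟦⟪⟫ₚ⟧ c ⊥ₚ x ≅∙ ⟪⟫ˢ-identityˡ c

  exchangeₚ : ∀ u v x y → ((u ∥ₚ v) ⨾ₚ (x ∥ₚ y)) ⊑ ((u ⨾ₚ x) ∥ₚ (v ⨾ₚ y))
  exchangeₚ u v x y = ↝⇒⊑
    (≅⇒↝ (⟦⟪⟫ₚ⟧ par (u ⨾ₚ x) (v ⨾ₚ y) ≅∙ ⟪⟫ˢ-cong par (⟦⟪⟫ₚ⟧ seq u x) (⟦⟪⟫ₚ⟧ seq v y))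
      ↝∙ exchangeˢ
      ↝∙ ≅⇒↝ (⟪⟫ˢ-cong seq (≅-sym (⟦⟪⟫ₚ⟧ par u v)) (≅-sym (⟦⟪⟫ₚ⟧ par x y))
               ≅∙ ≅-sym (⟦⟪⟫ₚ⟧ seq (u ∥ₚ v) (x ∥ₚ y))))

  ⊆-refl : ∀ X → X ⊆ X
  ⊆-refl _ _ = id

  ∪-least : ∀ X Y Z → X ⊆ Z → Y ⊆ Z → (X ∪ Y) ⊆ Z
  ∪-least _ _ _ X⊆Z Y⊆Z p = [ X⊆Z p , Y⊆Z p ]

  ⋃-upper : ∀ {I : Set} (F : I → Program) i → F i ⊆ ⋃ F
  ⋃-upper F i _ = i ,_

  ⋃-least : ∀ {I : Set} (F : I → Program) Z → (∀ i → F i ⊆ Z) → ⋃ F ⊆ Z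
  ⋃-least F Z F⊆Z p (i , m) = F⊆Z i p m

  ∈-⟪⟫ : ∀ c X Y {x y} → mem X x → mem Y y → mem (X ⟪ c ⟫ Y) (x ⟪ c ⟫ₚ y)
  ∈-⟪⟫ c X Y {x} {y} x∈X y∈Y =
    ⟪⟫ₚ-isPartialString c (isPS X x x∈X) (isPS Y y y∈Y) , _ , (x , y , x∈X , y∈Y , refl) , ⊑-refl

  ⟪⟫-least-⊑ : ∀ c X Y Z →
    (∀ {x y} → mem X x → mem Y y → ∃ λ z → mem Z z × (x ⟪ c ⟫ₚ y) ⊑ z) → (X ⟪ c ⟫ Y) ⊆ Z
  ⟪⟫-least-⊑ c X Y Z dominated p (p-ps , _ , (x , y , x∈X , y∈Y , refl) , p⊑xy) =
    let z , z∈Z , xy⊑z = dominated x∈X y∈Y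
    in  closed Z z p z∈Z p-ps (⊑-trans {p} {x ⟪ c ⟫ₚ y} {z} p⊑xy xy⊑z)

  ⟪⟫-least : ∀ c X Y Z → (∀ {x y} → mem X x → mem Y y → mem Z (x ⟪ c ⟫ₚ y)) → (X ⟪ c ⟫ Y) ⊆ Z
  ⟪⟫-least c X Y Z generators∈Z =
    ⟪⟫-least-⊑ c X Y Z λ {x} {y} x∈X y∈Y → x ⟪ c ⟫ₚ y , generators∈Z x∈X y∈Y , ⊑-refl

  ⟪⟫-mono : ∀ c X X' Y Y' → X ⊆ X' → Y ⊆ Y' → (X ⟪ c ⟫ Y) ⊆ (X' ⟪ c ⟫ Y')
  ⟪⟫-mono c X X' Y Y' X⊆X' Y⊆Y' =
    ⟪⟫-least c X Y (X' ⟪ c ⟫ Y') λ x∈X y∈Y → ∈-⟪⟫ c X' Y' (X⊆X' _ x∈X) (Y⊆Y' _ y∈Y)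

  ⟪⟫-cong : ∀ c {X X' Y Y'} → X ≐ X' → Y ≐ Y' → (X ⟪ c ⟫ Y) ≐ (X' ⟪ c ⟫ Y')
  ⟪⟫-cong c {X} {X'} {Y} {Y'} (X⊆X' , X'⊆X) (Y⊆Y' , Y'⊆Y) =
    ⟪⟫-mono c X X' Y Y' X⊆X' Y⊆Y' , ⟪⟫-mono c X' X Y' Y X'⊆X Y'⊆Y

  ⟪⟫-assocʳ : ∀ c X Y Z → ((X ⟪ c ⟫ Y) ⟪ c ⟫ Z) ⊆ (X ⟪ c ⟫ (Y ⟪ c ⟫ Z))
  ⟪⟫-assocʳ c X Y Z = ⟪⟫-least-⊑ c (X ⟪ c ⟫ Y) Z (X ⟪ c ⟫ (Y ⟪ c ⟫ Z)) λ
    { {w} {z} (_ , _ , (x , y , x∈X , y∈Y , refl) , w⊑xy) z∈Z →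
        x ⟪ c ⟫ₚ (y ⟪ c ⟫ₚ z) , ∈-⟪⟫ c X (Y ⟪ c ⟫ Z) x∈X (∈-⟪⟫ c Y Z y∈Y z∈Z)
          , ⊑-trans {w ⟪ c ⟫ₚ z} {(x ⟪ c ⟫ₚ y) ⟪ c ⟫ₚ z}
              (⟪⟫ₚ-mono c {x = x ⟪ c ⟫ₚ y} {y = z} w⊑xy (⊑-refl {z})) (≅⇒⊑ (⟪⟫ₚ-assoc c x y z)) }

  ⟪⟫-assocˡ : ∀ c X Y Z → (X ⟪ c ⟫ (Y ⟪ c ⟫ Z)) ⊆ ((X ⟪ c ⟫ Y) ⟪ c ⟫ Z)
  ⟪⟫-assocˡ c X Y Z = ⟪⟫-least-⊑ c X (Y ⟪ c ⟫ Z) ((X ⟪ c ⟫ Y) ⟪ c ⟫ Z) λ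
    { {x} {w} x∈X (_ , _ , (y , z , y∈Y , z∈Z , refl) , w⊑yz) →
        (x ⟪ c ⟫ₚ y) ⟪ c ⟫ₚ z , ∈-⟪⟫ c (X ⟪ c ⟫ Y) Z (∈-⟪⟫ c X Y x∈X y∈Y) z∈Z
          , ⊑-trans {x ⟪ c ⟫ₚ w} {x ⟪ c ⟫ₚ (y ⟪ c ⟫ₚ z)}
              (⟪⟫ₚ-mono c {y = y ⟪ c ⟫ₚ z} (⊑-refl {x}) w⊑yz) (≅⇒⊒ (⟪⟫ₚ-assoc c x y z)) }

  ⟪⟫-assoc : ∀ c X Y Z → (X ⟪ c ⟫ (Y ⟪ c ⟫ Z)) ≐ ((X ⟪ c ⟫ Y) ⟪ c ⟫ Z)
  ⟪⟫-assoc c X Y Z = ⟪⟫-assocˡ c X Y Z , ⟪⟫-assocʳ c X Y Z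

  ⊥ₚ∈𝟙 : mem 𝟙 ⊥ₚ
  ⊥ₚ∈𝟙 = ⊥ₚ-isPartialString , ⊥ₚ , refl , ⊑-refl

  ⟪⟫-identityʳ : ∀ c X → (X ⟪ c ⟫ 𝟙) ≐ X
  ⟪⟫-identityʳ c X =
      ⟪⟫-least-⊑ c X 𝟙 X (λ { {x} {e} x∈X (_ , _ , refl , e⊑⊥) →
        x , x∈X , ⊑-trans {x ⟪ c ⟫ₚ e} {x ⟪ c ⟫ₚ ⊥ₚ}
                    (⟪⟫ₚ-mono c {y = ⊥ₚ} (⊑-refl {x}) e⊑⊥) (≅⇒⊑ (⟪⟫ₚ-identityʳ c x)) })
    , λ x x∈X → closed (X ⟪ c ⟫ 𝟙) _ x (∈-⟪⟫ c X 𝟙 x∈X ⊥ₚ∈𝟙) (isPS X x x∈X) (≅⇒⊒ (⟪⟫ₚ-identityʳ c x))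

  ⟪⟫-identityˡ : ∀ c X → (𝟙 ⟪ c ⟫ X) ≐ X
  ⟪⟫-identityˡ c X =
      ⟪⟫-least-⊑ c 𝟙 X X (λ { {e} {x} (_ , _ , refl , e⊑⊥) x∈X →
        x , x∈X , ⊑-trans {e ⟪ c ⟫ₚ x} {⊥ₚ ⟪ c ⟫ₚ x}
                    (⟪⟫ₚ-mono c {x = ⊥ₚ} e⊑⊥ (⊑-refl {x})) (≅⇒⊑ (⟪⟫ₚ-identityˡ c x)) })
    , λ x x∈X → closed (𝟙 ⟪ c ⟫ X) _ x (∈-⟪⟫ c 𝟙 X ⊥ₚ∈𝟙 x∈X) (isPS X x x∈X) (≅⇒⊒ (⟪⟫ₚ-identityˡ c x))

  ⟪⟫-zeroʳ : ∀ c X → (X ⟪ c ⟫ 𝟘) ≐ 𝟘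
  ⟪⟫-zeroʳ c X = ⟪⟫-least-⊑ c X 𝟘 𝟘 (λ _ ()) , λ _ ()

  ⟪⟫-zeroˡ : ∀ c X → (𝟘 ⟪ c ⟫ X) ≐ 𝟘
  ⟪⟫-zeroˡ c X = ⟪⟫-least-⊑ c 𝟘 X 𝟘 (λ ()) , λ _ ()

  ∥-comm : ∀ X Y → (X ∥ Y) ⊆ (Y ∥ X)
  ∥-comm X Y = ⟪⟫-least-⊑ par X Y (Y ∥ X) λ {x} {y} x∈X y∈Y →
    y ∥ₚ x , ∈-⟪⟫ par Y X y∈Y x∈X , ≅⇒⊑ (∥ₚ-comm x y)

  exchange : ∀ U V X Y → ((U ∥ V) ⨾ (X ∥ Y)) ⊆ ((U ⨾ X) ∥ (V ⨾ Y))
  exchange U V X Y = ⟪⟫-least-⊑ seq (U ∥ V) (X ∥ Y) ((U ⨾ X) ∥ (V ⨾ Y)) λ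
    { {w} {w'} (_ , _ , (u , v , u∈U , v∈V , refl) , w⊑uv) (_ , _ , (x , y , x∈X , y∈Y , refl) , w'⊑xy) →
        (u ⨾ₚ x) ∥ₚ (v ⨾ₚ y) , ∈-⟪⟫ par (U ⨾ X) (V ⨾ Y) (∈-⟪⟫ seq U X u∈U x∈X) (∈-⟪⟫ seq V Y v∈V y∈Y)
          , ⊑-trans {w ⨾ₚ w'} {(u ∥ₚ v) ⨾ₚ (x ∥ₚ y)}
              (⟪⟫ₚ-mono seq {x = u ∥ₚ v} {y = x ∥ₚ y} w⊑uv w'⊑xy) (exchangeₚ u v x y) }

  ⟪⟫-distribˡ-⋃ : ∀ c X {I : Set} (F : I → Program) → (X ⟪ c ⟫ ⋃ F) ≐ ⋃ (λ i → X ⟪ c ⟫ F i)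
  ⟪⟫-distribˡ-⋃ c X F =
      ⟪⟫-least c X (⋃ F) (⋃ λ i → X ⟪ c ⟫ F i) (λ { x∈X (i , y∈Fi) → i , ∈-⟪⟫ c X (F i) x∈X y∈Fi })
    , ⋃-least (λ i → X ⟪ c ⟫ F i) (X ⟪ c ⟫ ⋃ F) (λ i → ⟪⟫-mono c X X (F i) (⋃ F) (⊆-refl X) (⋃-upper F i))

  ⟪⟫-distribʳ-⋃ : ∀ c X {I : Set} (F : I → Program) → (⋃ F ⟪ c ⟫ X) ≐ ⋃ (λ i → F i ⟪ c ⟫ X)
  ⟪⟫-distribʳ-⋃ c X F =
      ⟪⟫-least c (⋃ F) X (⋃ λ i → F i ⟪ c ⟫ X) (λ { (i , x∈Fi) y∈X → i , ∈-⟪⟫ c (F i) X x∈Fi y∈X })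
    , ⋃-least (λ i → F i ⟪ c ⟫ X) (⋃ F ⟪ c ⟫ X) (λ i → ⟪⟫-mono c (F i) (⋃ F) X X (⋃-upper F i) (⊆-refl X))

  ⟪⟫-distribˡ-∪ : ∀ c X Y Z → (X ⟪ c ⟫ (Y ∪ Z)) ≐ ((X ⟪ c ⟫ Y) ∪ (X ⟪ c ⟫ Z))
  ⟪⟫-distribˡ-∪ c X Y Z =
      ⟪⟫-least c X (Y ∪ Z) ((X ⟪ c ⟫ Y) ∪ (X ⟪ c ⟫ Z))
          (λ { x∈X (inj₁ y∈Y) → inj₁ (∈-⟪⟫ c X Y x∈X y∈Y)
             ; x∈X (inj₂ z∈Z) → inj₂ (∈-⟪⟫ c X Z x∈X z∈Z) })
    , ∪-least (X ⟪ c ⟫ Y) (X ⟪ c ⟫ Z) (X ⟪ c ⟫ (Y ∪ Z))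
          (⟪⟫-mono c X X Y (Y ∪ Z) (⊆-refl X) (λ _ → inj₁))
          (⟪⟫-mono c X X Z (Y ∪ Z) (⊆-refl X) (λ _ → inj₂))

  ⟪⟫-distribʳ-∪ : ∀ c X Y Z → ((X ∪ Y) ⟪ c ⟫ Z) ≐ ((X ⟪ c ⟫ Z) ∪ (Y ⟪ c ⟫ Z))
  ⟪⟫-distribʳ-∪ c X Y Z =
      ⟪⟫-least c (X ∪ Y) Z ((X ⟪ c ⟫ Z) ∪ (Y ⟪ c ⟫ Z))
          (λ { (inj₁ x∈X) z∈Z → inj₁ (∈-⟪⟫ c X Z x∈X z∈Z)
             ; (inj₂ y∈Y) z∈Z → inj₂ (∈-⟪⟫ c Y Z y∈Y z∈Z) })
    , ∪-least (X ⟪ c ⟫ Z) (Y ⟪ c ⟫ Z) ((X ∪ Y) ⟪ c ⟫ Z)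
          (⟪⟫-mono c X (X ∪ Y) Z Z (λ _ → inj₁) (⊆-refl Z))
          (⟪⟫-mono c Y (X ∪ Y) Z Z (λ _ → inj₂) (⊆-refl Z))

  ⊆⇔∪≐ : ∀ X Y → (X ⊆ Y) ⇔ ((X ∪ Y) ≐ Y)
  ⊆⇔∪≐ X Y = mk⇔ (λ X⊆Y → ∪-least X Y Y X⊆Y (⊆-refl Y) , λ _ → inj₂) (λ (X∪Y⊆Y , _) p → X∪Y⊆Y p ∘ inj₁)

  ∪-assoc : ∀ X Y Z → (X ∪ (Y ∪ Z)) ≐ ((X ∪ Y) ∪ Z)
  ∪-assoc _ _ _ = (λ _ → assocˡ) , (λ _ → assocʳ)

  ∪-idem : ∀ X → (X ∪ X) ≐ X
  ∪-idem _ = (λ _ → reduce) , (λ _ → inj₁)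

  ∪-identityʳ : ∀ X → (X ∪ 𝟘) ≐ X
  ∪-identityʳ _ = (λ _ → [ id , ⊥-elim ]) , (λ _ → inj₁)

  ∪-identityˡ : ∀ X → (𝟘 ∪ X) ≐ X
  ∪-identityˡ _ = (λ _ → [ ⊥-elim , id ]) , (λ _ → inj₂)

  ∪-comm : ∀ X Y → (X ∪ Y) ≐ (Y ∪ X)
  ∪-comm _ _ = (λ _ → swap) , (λ _ → swap)

  ≐-isEquivalence : IsEquivalence _≐_
  ≐-isEquivalence = record
    { refl = λ {X} → ⊆-refl X , ⊆-refl X
    ; sym = λ (X⊆Y , Y⊆X) → Y⊆X , X⊆Y
    ; trans = λ (X⊆Y , Y⊆X) (Y⊆Z , Z⊆Y) → (λ p → Y⊆Z p ∘ X⊆Y p) , (λ p → Y⊆X p ∘ Z⊆Y p)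
    }

  ⊆-isPartialOrder : IsPartialOrder _≐_ _⊆_
  ⊆-isPartialOrder = record
    { isPreorder = record
        { isEquivalence = ≐-isEquivalence
        ; reflexive = proj₁
        ; trans = λ X⊆Y Y⊆Z p → Y⊆Z p ∘ X⊆Y p
        }
    ; antisym = _,_
    }

  ⋃-isCompleteLattice : IsCompleteLattice lzero _≐_ _⊆_ ⋃
  ⋃-isCompleteLattice = record
    { isPartialOrder = ⊆-isPartialOrder
    ; ⋁-upper = ⋃-upper
    ; ⋁-least = ⋃-least
    }

  ⟪⟫-isUnitalQuantale : ∀ c → IsUnitalQuantale lzero _≐_ _⊆_ ⋃ (λ X Y → X ⟪ c ⟫ Y) 𝟙
  ⟪⟫-isUnitalQuantale c = record
    { isCompleteLattice = ⋃-isCompleteLattice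
    ; isMonoid = record
        { isSemigroup = record
            { isMagma = record
                { isEquivalence = ≐-isEquivalence
                ; ∙-cong = λ {X X' Y Y'} → ⟪⟫-cong c {X} {X'} {Y} {Y'}
                }
            ; assoc = λ X Y Z → ⟪⟫-assocʳ c X Y Z , ⟪⟫-assocˡ c X Y Z
            }
        ; identity = ⟪⟫-identityˡ c , ⟪⟫-identityʳ c
        }
    ; distribˡ = ⟪⟫-distribˡ-⋃ c
    ; distribʳ = λ X F → ⟪⟫-distribʳ-⋃ c X F
    }

  iterate : (Program → Program) → ℕ → Program
  iterate φ zero = 𝟘
  iterate φ (suc n) = φ (iterate φ n)

  ⋃-iterate-isLeastFixedPoint : ∀ φ → (∀ X Y → X ⊆ Y → φ X ⊆ φ Y) →
    (∀ (F : ℕ → Program) → φ (⋃ F) ⊆ ⋃ (φ ∘ F)) → IsLeastFixedPoint φ (⋃ (iterate φ))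
  ⋃-iterate-isLeastFixedPoint φ φ-mono φ-continuous = (unfold , fold) , least
    where
    unfold : ⋃ (iterate φ) ⊆ φ (⋃ (iterate φ))
    unfold p (suc n , p∈) = φ-mono (iterate φ n) (⋃ (iterate φ)) (⋃-upper (iterate φ) n) p p∈
    fold : φ (⋃ (iterate φ)) ⊆ ⋃ (iterate φ)
    fold p p∈ = let n , p∈′ = φ-continuous (iterate φ) p p∈ in suc n , p∈′
    least : ∀ X → X ≐ φ X → ⋃ (iterate φ) ⊆ X
    least X (_ , φX⊆X) = ⋃-least (iterate φ) X below
      where
      below : ∀ n → iterate φ n ⊆ X
      below zero _ ()
      below (suc n) p = φX⊆X p ∘ φ-mono (iterate φ n) X (below n) p

  star : Program → Comp → Program
  star P c = ⋃ (iterate (λ X → 𝟙 ∪ (P ⟪ c ⟫ X)))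

  star-isLeastFixedPoint : ∀ P c → IsLeastFixedPoint (λ X → 𝟙 ∪ (P ⟪ c ⟫ X)) (star P c)
  star-isLeastFixedPoint P c = ⋃-iterate-isLeastFixedPoint _ mono continuous
    where
    mono : ∀ X Y → X ⊆ Y → (𝟙 ∪ (P ⟪ c ⟫ X)) ⊆ (𝟙 ∪ (P ⟪ c ⟫ Y))
    mono X Y X⊆Y p = map₂ (⟪⟫-mono c P P X Y (⊆-refl P) X⊆Y p)
    continuous : ∀ F → (𝟙 ∪ (P ⟪ c ⟫ ⋃ F)) ⊆ ⋃ (λ n → 𝟙 ∪ (P ⟪ c ⟫ F n))
    continuous F p (inj₁ p∈𝟙) = zero , inj₁ p∈𝟙
    continuous F p (inj₂ p∈PF) = let n , p∈ = proj₁ (⟪⟫-distribˡ-⋃ c P F) p p∈PF in n , inj₂ p∈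

mainTheorem1 : (Γ : Set) → let open PartialStrings Γ in
    IsCompleteLattice lzero _≐_ _⊆_ ⋃
    × (∀ X Y → (X ⊆ (X ∪ Y)) × (Y ⊆ (X ∪ Y))
    × (∀ Z → X ⊆ Z → Y ⊆ Z → (X ∪ Y) ⊆ Z))
    × (∀ X → 𝟘 ⊆ X)
    × (∀ (c : Comp) → IsUnitalQuantale lzero _≐_ _⊆_ ⋃ (λ X Y → X ⟪ c ⟫ Y) 𝟙)
    × (∀ U V X Y Z → ((X ⊆ Y) ⇔ ((X ∪ Y) ≐ Y))
    × (((U ∥ V) ⨾ (X ∥ Y)) ⊆ ((U ⨾ X) ∥ (V ⨾ Y)))
    × ((X ∪ (Y ∪ Z)) ≐ ((X ∪ Y) ∪ Z))
    × ((X ∪ X) ≐ X)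
    × ((X ∪ 𝟘) ≐ X) × ((𝟘 ∪ X) ≐ X)
    × ((X ∪ Y) ≐ (Y ∪ X))
    × ((X ∥ Y) ≐ (Y ∥ X))
    × ((X ∥ 𝟙) ≐ X) × ((𝟙 ∥ X) ≐ X)
    × ((X ⨾ 𝟙) ≐ X) × ((𝟙 ⨾ X) ≐ X)
    × ((X ∥ 𝟘) ≐ 𝟘) × ((𝟘 ∥ X) ≐ 𝟘)
    × ((X ⨾ 𝟘) ≐ 𝟘) × ((𝟘 ⨾ X) ≐ 𝟘)
    × (∀ (c : Comp) →
    ((X ⟪ c ⟫ (Y ∪ Z)) ≐ ((X ⟪ c ⟫ Y) ∪ (X ⟪ c ⟫ Z)))
    × (((X ∪ Y) ⟪ c ⟫ Z) ≐ ((X ⟪ c ⟫ Z) ∪ (Y ⟪ c ⟫ Z)))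
    × ((X ⟪ c ⟫ (Y ⟪ c ⟫ Z)) ≐ ((X ⟪ c ⟫ Y) ⟪ c ⟫ Z))))
    × (∀ (P : Program) (c : Comp) →
    ∃ λ (Pstar : Program) → IsLeastFixedPoint (λ X → 𝟙 ∪ (P ⟪ c ⟫ X)) Pstar)
mainTheorem1 Γ =
    ⋃-isCompleteLattice
  , (λ X Y → (λ _ → inj₁) , (λ _ → inj₂) , ∪-least X Y)
  , (λ _ _ ())
  , ⟪⟫-isUnitalQuantale
  , (λ U V X Y Z →
        ⊆⇔∪≐ X Y , exchange U V X Y
      , ∪-assoc X Y Z , ∪-idem X , ∪-identityʳ X , ∪-identityˡ X , ∪-comm X Y
      , (∥-comm X Y , ∥-comm Y X)
      , ⟪⟫-identityʳ par X , ⟪⟫-identityˡ par X , ⟪⟫-identityʳ seq X , ⟪⟫-identityˡ seq X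
      , ⟪⟫-zeroʳ par X , ⟪⟫-zeroˡ par X , ⟪⟫-zeroʳ seq X , ⟪⟫-zeroˡ seq X
      , λ c → ⟪⟫-distribˡ-∪ c X Y Z , ⟪⟫-distribʳ-∪ c X Y Z , ⟪⟫-assoc c X Y Z)
  , λ P c → star P c , star-isLeastFixedPoint P c
  where
  open PartialStrings Γ
  open PartialStringAlgebra Γ
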